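{- Let $c$ be an integer, $M\in R(c)$, and $i\ge 0$. Then $\tilde h_i\,\tilde h(M)=\tilde h([-i,i]+M)$, and this element lies in $\tilde{\mathrm{CH}}_2(c)$.
   Context: Let $\mathrm{CH}_2$ be the commutative ring which is a free $\mathbb{Z}$-module with basis $\{h_i : i\ge 0\}$ and multiplication $h_ih_j=\sum_{k=0}^{\min(i,j)}h_{i+j-2k}$. Let $\tilde{\mathrm{CH}}_2$ be the free $\mathbb{Z}$-module with basis $\{\tilde h_i : i\in\mathbb{Z}\}$, with left $\mathrm{CH}_2$-action $h_i\tilde h_j=\sum_{k=0}^{i}\tilde h_{j-i+2k}$ ($i\ge0$), extended bilinearly. Let $L:\tilde{\mathrm{CH}}_2\to \mathrm{CH}_2$ be the $\mathbb{Z}$-linear map with $L(\tilde h_{ -1})=0$, $L(\tilde h_i)=h_i$ for $i\ge 0$, $L(\tilde h_i)=-h_{ -i-2}$ for $i\le -2$; the product on $\tilde{\mathrm{CH}}_2$ is $g_1g_2:=L(g_1)\,g_2$. Multisets are finite multisets of integers; $\mathrm{mult}(i,M)$ is the multiplicity of $i$ in $M$; $\tilde h(M)=\sum_i\mathrm{mult}(i,M)\tilde h_i$; $M_1+M_2$ is the multiset $\{i_1+i_2:i_1\in M_1,i_2\in M_2\}$ counted with multiplicity; $\cup$ is multiset union. For integers $a\le b$, $a\equiv b\pmod 2$, $[a,b]=\{a,a+2,\dots,b\}$. For an integer $c$, $R(c)$ is the set of multisets of the form $\bigcup_{i=1}^{k_1}\{m_i\}\cup\bigcup_{i=1}^{k_2}[c-n_i,c+n_i]$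 with integers $k_1,k_2\ge0$, $m_i\ge c$, $n_i\ge1$, and $\tilde{\mathrm{CH}}_2(c)=\{\tilde h(M):M\in R(c)\}$. -}

module Defs where

open import Data.Nat as ℕ using (ℕ; zero; suc)
open import Data.Integer as ℤ using (ℤ; +_; -[1+_]; _+_; _*_; _-_; -_; _≤_)
open import Data.Integer using (_≟_)
open import Data.List using (List; []; _∷_; map; concatMap; sum; upTo; _++_)
open import Data.List.Relation.Unary.All using (All)
open import Data.List.Relation.Binary.Permutation.Propositional using (_↭_)
open import Data.Product using (_×_; _,_; ∃; ∃-syntax)
open import Relation.Binary.PropositionalEquality using (_≡_)
open import Relation.Nullary using (yes; no)

-- Elements of free ℤ-modules, represented as finite formal sums
-- (lists of coefficient/basis-index pairs).  Two formal sums denote the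
-- same element iff all their coefficients agree.

CH2 : Set
CH2 = List (ℤ × ℕ)

CH2~ : Set
CH2~ = List (ℤ × ℤ)

coeff~ : CH2~ → ℤ → ℤ
coeff~ [] j = + 0
coeff~ ((a , i) ∷ xs) j with i ≟ j
... | yes _ = a + coeff~ xs j
... | no  _ = coeff~ xs j

_≈~_ : CH2~ → CH2~ → Set
x ≈~ y = ∀ j → coeff~ x j ≡ coeff~ y j

infix 4 _≈~_

h~ : ℤ → CH2~
h~ i = (+ 1 , i) ∷ []

scale~ : ℤ → CH2~ → CH2~
scale~ a = map (λ { (b , j) → (a * b , j) })

-- h_i · h̃_j = Σ_{k=0}^{i} h̃_{j-i+2k}
hAct : ℕ → ℤ → CH2~
hAct i j = map (λ k → (+ 1 , j - + i + + (2 ℕ.* k))) (upTo (suc i))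

act : CH2 → CH2~ → CH2~
act x y = concatMap (λ { (a , i) → concatMap (λ { (b , j) → scale~ (a * b) (hAct i j) }) y }) x

Lbasis : ℤ → CH2
Lbasis (+ n)            = (+ 1 , n) ∷ []
Lbasis -[1+ zero ]      = []
Lbasis -[1+ suc m ]     = (- + 1 , m) ∷ []

L : CH2~ → CH2
L = concatMap (λ { (a , i) → map (λ { (b , k) → (a * b , k) }) (Lbasis i) })

_·~_ : CH2~ → CH2~ → CH2~
g₁ ·~ g₂ = act (L g₁) g₂

infixl 7 _·~_

-- Multisets of integers, represented as lists (up to permutation).

Multiset : Set
Multiset = List ℤ

hM : Multiset → CH2~
hM = map (λ i → (+ 1 , i))

_⊕_ : Multiset → Multiset → Multiset
M₁ ⊕ M₂ = concatMap (λ a → map (λ b → a + b) M₂) M₁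

infixl 6 _⊕_

-- [c - n, c + n] = {c-n, c-n+2, …, c+n}  (n ∈ ℕ)
seg : ℤ → ℕ → Multiset
seg c n = map (λ k → c - + n + + (2 ℕ.* k)) (upTo (suc n))

InR : ℤ → Multiset → Set
InR c M = ∃[ ms ] ∃[ ns ]
  (All (c ≤_) ms × All (1 ℕ.≤_) ns × (M ↭ (ms ++ concatMap (seg c) ns)))

InCH2~ : ℤ → CH2~ → Set
InCH2~ c x = ∃[ M ] (InR c M × x ≈~ hM M)

-- Since L(h̃ᵢ) = hᵢ, the product h̃ᵢ h̃(M) is the sum over j ∈ M of hᵢ h̃ⱼ = h̃(j + [-i,i]),
-- which is h̃([-i,i] + M) up to reordering, and reordering a formal sum does not change
-- its coefficients.  Membership in R(c) is then checked piece by piece, because the sumset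
-- distributes over unions.  For a singleton m ≥ c, the segment m + [-i,i] consists of
-- terms ≥ c, possibly preceded by a segment centred at c.  For a segment centred at c,
-- the Clebsch–Gordan rule
-- [-i,i] + [c-n,c+n] = [c-(i+n),c+(i+n)] ∪ ([-(i-1),i-1] + [c-(n-1),c+(n-1)])
-- reduces the radii until one of them is zero.
module Submission where

open import Defs
open import Data.Nat using (ℕ)
open import Data.Integer using (ℤ; +_)
open import Data.Product using (_×_)

open import Data.Nat using (zero; suc; s≤s; z≤n)
import Data.Nat as ℕ
import Data.Nat.Properties as ℕₚ
open import Data.Integer using (_+_; _*_; _-_; -_; _≤_; _≟_; ∣_∣)
import Data.Integer.Properties as ℤₚ
open import Data.Integer.Tactic.RingSolver using (solve-∀)
open import Data.List using (List; []; _∷_; [_]; _++_; map; concatMap; applyUpTo; upTo)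
import Data.List.Properties as List
open import Data.List.Relation.Unary.All as All using (All; []; _∷_)
import Data.List.Relation.Unary.All.Properties as All
open import Data.List.Relation.Binary.Permutation.Propositional
  using (_↭_; refl; prep; swap; trans; ↭-sym; ↭-trans; ↭-reflexive; module PermutationReasoning)
open import Data.List.Relation.Binary.Permutation.Propositional.Properties
  using (map⁺; ++⁺; ++⁺ˡ; ++-comm; ++-assoc; shifts)
open import Data.Product using (_,_; ∃)
open import Data.Sum using (inj₁; inj₂)
open import Function using (id)
open import Relation.Binary.PropositionalEquality
  using (_≡_; refl; sym; cong; cong₂; subst; module ≡-Reasoning)
  renaming (trans to ≡-trans)
open import Relation.Nullary using (yes; no)
open import Algebra.Properties.CommutativeSemigroup ℤₚ.+-commutativeSemigroup using (x∙yz≈y∙xz)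

progression : ℤ → ℕ → List ℤ
progression a zero    = []
progression a (suc l) = a ∷ progression (a + + 2) l

private
  pos-suc : ∀ n → + suc n ≡ + 1 + + n
  pos-suc = ℤₚ.pos-+ 1

  +2*-suc : ∀ a k → a + + 2 * + suc k ≡ a + + 2 + + 2 * + k
  +2*-suc a k = ≡-trans (cong (λ z → a + + 2 * z) (pos-suc k)) (ring a (+ k))
    where ring : ∀ a K → a + + 2 * (+ 1 + K) ≡ a + + 2 + + 2 * K
          ring = solve-∀

applyUpTo-progression : ∀ a l (f : ℕ → ℤ) → (∀ k → f k ≡ a + + 2 * + k) →
                        applyUpTo f l ≡ progression a l
applyUpTo-progression a zero    f f≗ = refl
applyUpTo-progression a (suc l) f f≗ =
  cong₂ _∷_ (≡-trans (f≗ 0) (ℤₚ.+-identityʳ a))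
            (applyUpTo-progression (a + + 2) l (λ k → f (suc k))
                                   (λ k → ≡-trans (f≗ (suc k)) (+2*-suc a k)))

seg≡progression : ∀ x n → seg x n ≡ progression (x - + n) (suc n)
seg≡progression x n =
  ≡-trans (List.map-applyUpTo id _ (suc n))
          (applyUpTo-progression _ (suc n) _ (λ k → cong (_+_ (x - + n)) (ℤₚ.pos-* 2 k)))

progression-++ : ∀ a l m → progression a (l ℕ.+ m) ≡ progression a l ++ progression (a + + 2 * + l) m
progression-++ a zero    m = cong (λ z → progression z m) (sym (ℤₚ.+-identityʳ a))
progression-++ a (suc l) m =
  cong (a ∷_) (≡-trans (progression-++ (a + + 2) l m)
                       (cong (λ z → progression (a + + 2) l ++ progression z m) (sym (+2*-suc a l))))

progression-∷ʳ : ∀ a l → progression a (suc l) ≡ progression a l ++ [ a + + 2 * + l ]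
progression-∷ʳ a l = ≡-trans (cong (progression a) (ℕₚ.+-comm 1 l)) (progression-++ a l 1)

map-progressionˡ : ∀ d a l → map (_+_ d) (progression a l) ≡ progression (d + a) l
map-progressionˡ d a zero    = refl
map-progressionˡ d a (suc l) =
  cong (d + a ∷_) (≡-trans (map-progressionˡ d (a + + 2) l)
                           (cong (λ z → progression z l) (sym (ℤₚ.+-assoc d a (+ 2)))))

map-progressionʳ : ∀ d a l → map (_+ d) (progression a l) ≡ progression (a + d) l
map-progressionʳ d a zero    = refl
map-progressionʳ d a (suc l) =
  cong (a + d ∷_) (≡-trans (map-progressionʳ d (a + + 2) l) (cong (λ z → progression z l) (ring a d)))
  where ring : ∀ a d → a + + 2 + d ≡ a + d + + 2
        ring = solve-∀

progression-lowerBound : ∀ {c a} l → c ≤ a → All (c ≤_) (progression a l)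
progression-lowerBound zero    c≤a = []
progression-lowerBound (suc l) c≤a = c≤a ∷ progression-lowerBound l (ℤₚ.≤-trans c≤a (ℤₚ.i≤i+j _ (+ 2)))

seg-zero : ∀ x → seg x 0 ≡ [ x ]
seg-zero x = cong [_] (ring x)
  where ring : ∀ x → x - + 0 + + 0 ≡ x
        ring = solve-∀

map-segˡ : ∀ d x n → map (_+_ d) (seg x n) ≡ seg (d + x) n
map-segˡ d x n = begin
  map (_+_ d) (seg x n)                 ≡⟨ cong (map (_+_ d)) (seg≡progression x n) ⟩
  map (_+_ d) (progression (x - + n) _) ≡⟨ map-progressionˡ d (x - + n) (suc n) ⟩
  progression (d + (x - + n)) _         ≡⟨ cong (λ z → progression z (suc n)) (sym (ℤₚ.+-assoc d x (- + n))) ⟩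
  progression (d + x - + n) _           ≡⟨ sym (seg≡progression (d + x) n) ⟩
  seg (d + x) n                         ∎
  where open ≡-Reasoning

map-segʳ : ∀ d x n → map (_+ d) (seg x n) ≡ seg (x + d) n
map-segʳ d x n = begin
  map (_+ d) (seg x n)                  ≡⟨ cong (map (_+ d)) (seg≡progression x n) ⟩
  map (_+ d) (progression (x - + n) _)  ≡⟨ map-progressionʳ d (x - + n) (suc n) ⟩
  progression (x - + n + d) _           ≡⟨ cong (λ z → progression z (suc n)) (ring x (+ n) d) ⟩
  progression (x + d - + n) _           ≡⟨ sym (seg≡progression (x + d) n) ⟩
  seg (x + d) n                         ∎
  where open ≡-Reasoning
        ring : ∀ x n d → x - n + d ≡ x + d - n
        ring = solve-∀

concatMap⁺ : ∀ {A B : Set} (f : A → List B) {xs ys} → xs ↭ ys → concatMap f xs ↭ concatMap f ys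
concatMap⁺ f refl         = refl
concatMap⁺ f (prep x p)   = ++⁺ˡ (f x) (concatMap⁺ f p)
concatMap⁺ f (swap x y p) = ↭-trans (shifts (f x) (f y)) (++⁺ˡ (f y) (++⁺ˡ (f x) (concatMap⁺ f p)))
concatMap⁺ f (trans p q)  = ↭-trans (concatMap⁺ f p) (concatMap⁺ f q)

⊕-zeroʳ : ∀ xs → xs ⊕ [] ≡ []
⊕-zeroʳ []       = refl
⊕-zeroʳ (x ∷ xs) = ⊕-zeroʳ xs

⊕-∷ʳ : ∀ xs y ys → xs ⊕ (y ∷ ys) ↭ map (_+_ y) xs ++ xs ⊕ ys
⊕-∷ʳ []       y ys = refl
⊕-∷ʳ (x ∷ xs) y ys = begin
  x + y ∷ map (_+_ x) ys ++ xs ⊕ (y ∷ ys)            ↭⟨ prep (x + y) (++⁺ˡ (map (_+_ x) ys) (⊕-∷ʳ xs y ys)) ⟩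
  x + y ∷ map (_+_ x) ys ++ map (_+_ y) xs ++ xs ⊕ ys  ↭⟨ prep (x + y) (shifts (map (_+_ x) ys) (map (_+_ y) xs)) ⟩
  x + y ∷ rest                                         ≡⟨ cong (_∷ rest) (ℤₚ.+-comm x y) ⟩
  y + x ∷ rest                                         ∎
  where
  open PermutationReasoning
  rest = map (_+_ y) xs ++ map (_+_ x) ys ++ xs ⊕ ys

⊕-comm : ∀ xs ys → xs ⊕ ys ↭ ys ⊕ xs
⊕-comm []       ys = ↭-reflexive (sym (⊕-zeroʳ ys))
⊕-comm (x ∷ xs) ys = ↭-trans (++⁺ˡ (map (_+_ x) ys) (⊕-comm xs ys)) (↭-sym (⊕-∷ʳ ys x xs))

⊕-distribʳ-++ : ∀ xs ys zs → xs ⊕ (ys ++ zs) ↭ xs ⊕ ys ++ xs ⊕ zs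
⊕-distribʳ-++ xs ys zs = begin
  xs ⊕ (ys ++ zs)        ↭⟨ ⊕-comm xs (ys ++ zs) ⟩
  (ys ++ zs) ⊕ xs        ≡⟨ List.concatMap-++ _ ys zs ⟩
  ys ⊕ xs ++ zs ⊕ xs     ↭⟨ ++⁺ (⊕-comm ys xs) (⊕-comm zs xs) ⟩
  xs ⊕ ys ++ xs ⊕ zs     ∎
  where open PermutationReasoning

⊕-singletonʳ : ∀ xs z → xs ⊕ [ z ] ≡ map (_+ z) xs
⊕-singletonʳ []       z = refl
⊕-singletonʳ (x ∷ xs) z = cong (x + z ∷_) (⊕-singletonʳ xs z)

⊕-shift : ∀ d xs ys → map (_+ d) xs ⊕ ys ≡ xs ⊕ map (_+ d) ys
⊕-shift d []       ys = refl
⊕-shift d (x ∷ xs) ys = cong₂ _++_ row (⊕-shift d xs ys)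
  where row : map (_+_ (x + d)) ys ≡ map (_+_ x) (map (_+ d) ys)
        row = ≡-trans (List.map-cong (λ y → ring x d y) ys) (List.map-∘ ys)
          where ring : ∀ x d y → x + d + y ≡ x + (y + d)
                ring = solve-∀

-- In the grid of sums of the two progressions, the first row followed by the last column
-- is one progression; the remaining grid is the sumset of the shortened progressions,
-- each re-centred by one.
progression-⊕-hook : ∀ a b l m →
  progression a (suc l) ⊕ progression b (suc m)
    ↭ progression (a + b) (suc m ℕ.+ l) ++ progression (a + + 1) l ⊕ progression (b + + 1) m
progression-⊕-hook a b l m = begin
  progression a (suc l) ⊕ progression b (suc m)
    ≡⟨ cong₂ _++_ (map-progressionˡ a b (suc m)) (cong (P₂ ⊕_) (progression-∷ʳ b m)) ⟩
  progression (a + b) (suc m) ++ P₂ ⊕ (progression b m ++ [ z ])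
    ↭⟨ ++⁺ˡ (progression (a + b) (suc m)) (⊕-distribʳ-++ P₂ (progression b m) [ z ]) ⟩
  progression (a + b) (suc m) ++ (P₂ ⊕ progression b m ++ P₂ ⊕ [ z ])
    ↭⟨ ++⁺ˡ (progression (a + b) (suc m)) (++-comm (P₂ ⊕ progression b m) (P₂ ⊕ [ z ])) ⟩
  progression (a + b) (suc m) ++ (P₂ ⊕ [ z ] ++ P₂ ⊕ progression b m)
    ≡⟨ cong₂ (λ u v → progression (a + b) (suc m) ++ (u ++ v)) tail middle ⟩
  progression (a + b) (suc m) ++ (progression (a + b + + 2 * + suc m) l ++ P₁ ⊕ progression (b + + 1) m)
    ≡⟨ List.++-assoc (progression (a + b) (suc m)) _ _ ⟨
  (progression (a + b) (suc m) ++ progression (a + b + + 2 * + suc m) l) ++ P₁ ⊕ progression (b + + 1) m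
    ≡⟨ cong (_++ P₁ ⊕ progression (b + + 1) m) (progression-++ (a + b) (suc m) l) ⟨
  progression (a + b) (suc m ℕ.+ l) ++ P₁ ⊕ progression (b + + 1) m
    ∎
  where
  open PermutationReasoning
  P₁ = progression (a + + 1) l
  P₂ = progression (a + + 2) l
  z  = b + + 2 * + m

  tail : P₂ ⊕ [ z ] ≡ progression (a + b + + 2 * + suc m) l
  tail = ≡-trans (⊕-singletonʳ P₂ z)
                 (≡-trans (map-progressionʳ z (a + + 2) l)
                          (cong (λ s → progression s l) (≡-trans (ring a b (+ m)) (sym (+2*-suc (a + b) m)))))
    where ring : ∀ a b m → a + + 2 + (b + + 2 * m) ≡ a + b + + 2 + + 2 * m
          ring = solve-∀

  middle : P₂ ⊕ progression b m ≡ P₁ ⊕ progression (b + + 1) m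
  middle = ≡-trans (cong (_⊕ progression b m) (sym shiftP₁))
                   (≡-trans (⊕-shift (+ 1) P₁ (progression b m))
                            (cong (P₁ ⊕_) (map-progressionʳ (+ 1) b m)))
    where shiftP₁ : map (_+ + 1) P₁ ≡ P₂
          shiftP₁ = ≡-trans (map-progressionʳ (+ 1) (a + + 1) l)
                            (cong (λ s → progression s l) (ℤₚ.+-assoc a (+ 1) (+ 1)))

seg-⊕-hook : ∀ x y i n →
  seg x (suc i) ⊕ seg y (suc n) ↭ seg (x + y) (suc n ℕ.+ suc i) ++ seg x i ⊕ seg y n
seg-⊕-hook x y i n = begin
  seg x (suc i) ⊕ seg y (suc n)
    ≡⟨ cong₂ _⊕_ (seg≡progression x (suc i)) (seg≡progression y (suc n)) ⟩
  progression (x - + suc i) (suc (suc i)) ⊕ progression (y - + suc n) (suc (suc n))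
    ↭⟨ progression-⊕-hook (x - + suc i) (y - + suc n) (suc i) (suc n) ⟩
  progression (x - + suc i + (y - + suc n)) (suc (suc n ℕ.+ suc i))
    ++ progression (x - + suc i + + 1) (suc i) ⊕ progression (y - + suc n + + 1) (suc n)
    ≡⟨ cong₂ (λ s t → s ++ t) outer (cong₂ _⊕_ (inner x i) (inner y n)) ⟨
  progression (x + y - + (suc n ℕ.+ suc i)) (suc (suc n ℕ.+ suc i))
    ++ progression (x - + i) (suc i) ⊕ progression (y - + n) (suc n)
    ≡⟨ cong₂ (λ s t → s ++ t) (seg≡progression (x + y) (suc n ℕ.+ suc i))
                              (cong₂ _⊕_ (seg≡progression x i) (seg≡progression y n)) ⟨
  seg (x + y) (suc n ℕ.+ suc i) ++ seg x i ⊕ seg y n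
    ∎
  where
  open PermutationReasoning

  outer : progression (x + y - + (suc n ℕ.+ suc i)) (suc (suc n ℕ.+ suc i))
        ≡ progression (x - + suc i + (y - + suc n)) (suc (suc n ℕ.+ suc i))
  outer = cong (λ s → progression s (suc (suc n ℕ.+ suc i)))
               (≡-trans (cong (λ k → x + y - k) (ℤₚ.pos-+ (suc n) (suc i))) (ring x y (+ suc i) (+ suc n)))
    where ring : ∀ x y i n → x + y - (n + i) ≡ x - i + (y - n)
          ring = solve-∀

  inner : ∀ x k → progression (x - + k) (suc k) ≡ progression (x - + suc k + + 1) (suc k)
  inner x k = cong (λ s → progression s (suc k))
                   (≡-trans (ring x (+ k)) (cong (λ j → x - j + + 1) (sym (pos-suc k))))
    where ring : ∀ x k → x - k ≡ x - (+ 1 + k) + + 1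
          ring = solve-∀

InR-≡ : ∀ {c M N} → M ≡ N → InR c N → InR c M
InR-≡ refl M∈R = M∈R

InR-↭ : ∀ {c M N} → M ↭ N → InR c N → InR c M
InR-↭ M↭N (ms , ns , ms≥c , ns≥1 , N↭) = ms , ns , ms≥c , ns≥1 , ↭-trans M↭N N↭

InR-[] : ∀ {c} → InR c []
InR-[] = [] , [] , [] , [] , refl

InR-++ : ∀ {c M N} → InR c M → InR c N → InR c (M ++ N)
InR-++ {c} {M} {N} (ms₁ , ns₁ , ms₁≥c , ns₁≥1 , M↭) (ms₂ , ns₂ , ms₂≥c , ns₂≥1 , N↭) =
  ms₁ ++ ms₂ , ns₁ ++ ns₂ , All.++⁺ ms₁≥c ms₂≥c , All.++⁺ ns₁≥1 ns₂≥1 , regroup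
  where
  open PermutationReasoning
  S₁ = concatMap (seg c) ns₁
  S₂ = concatMap (seg c) ns₂
  regroup : M ++ N ↭ (ms₁ ++ ms₂) ++ concatMap (seg c) (ns₁ ++ ns₂)
  regroup = begin
    M ++ N                       ↭⟨ ++⁺ M↭ N↭ ⟩
    (ms₁ ++ S₁) ++ (ms₂ ++ S₂)   ↭⟨ ++-assoc ms₁ S₁ (ms₂ ++ S₂) ⟩
    ms₁ ++ (S₁ ++ (ms₂ ++ S₂))   ↭⟨ ++⁺ˡ ms₁ (shifts S₁ ms₂) ⟩
    ms₁ ++ (ms₂ ++ (S₁ ++ S₂))   ↭⟨ ++-assoc ms₁ ms₂ (S₁ ++ S₂) ⟨
    (ms₁ ++ ms₂) ++ (S₁ ++ S₂)   ≡⟨ cong ((ms₁ ++ ms₂) ++_) (List.concatMap-++ (seg c) ns₁ ns₂) ⟨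
    (ms₁ ++ ms₂) ++ concatMap (seg c) (ns₁ ++ ns₂) ∎

InR-lowerBound : ∀ {c M} → All (c ≤_) M → InR c M
InR-lowerBound {M = M} M≥c = M , [] , M≥c , [] , ↭-reflexive (sym (List.++-identityʳ M))

InR-seg : ∀ c n → InR c (seg c n)
InR-seg c zero    = InR-≡ (seg-zero c) (InR-lowerBound (ℤₚ.≤-refl ∷ []))
InR-seg c (suc n) = [] , [ suc n ] , [] , s≤s z≤n ∷ [] , ↭-reflexive (sym (List.++-identityʳ _))

InR-seg-+ : ∀ c d i → InR c (seg (c + + d) i)
InR-seg-+ c d i with ℕₚ.≤-total i d
... | inj₁ i≤d with ℕₚ.m≤n⇒∃[o]m+o≡n i≤d
...   | e , refl = InR-lowerBound (subst (All (c ≤_)) (sym (seg≡progression (c + + d) i))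
                                         (progression-lowerBound (suc i) c≤start))
  where
  start≡ : c + + (i ℕ.+ e) - + i ≡ c + + e
  start≡ = ≡-trans (cong (λ t → c + t - + i) (ℤₚ.pos-+ i e)) (ring c (+ i) (+ e))
    where ring : ∀ c i e → c + (i + e) - i ≡ c + e
          ring = solve-∀
  c≤start : c ≤ c + + (i ℕ.+ e) - + i
  c≤start = ℤₚ.≤-trans (ℤₚ.i≤i+j c (+ e)) (ℤₚ.≤-reflexive (sym start≡))
InR-seg-+ c d i | inj₂ d≤i with ℕₚ.m≤n⇒∃[o]m+o≡n d≤i
...   | k , refl = InR-≡ split (InR-++ (InR-seg c k) (InR-lowerBound (progression-lowerBound d c≤start)))
  where
  s = c + + d - + (d ℕ.+ k)
  s≡ : s ≡ c - + k
  s≡ = ≡-trans (cong (λ t → c + + d - t) (ℤₚ.pos-+ d k)) (ring c (+ d) (+ k))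
    where ring : ∀ c d k → c + d - (d + k) ≡ c - k
          ring = solve-∀
  end≡ : s + + 2 * + suc k ≡ c + + suc (suc k)
  end≡ = ≡-trans (cong (λ t → t + + 2 * + suc k) s≡)
                 (≡-trans (cong (λ t → c - + k + + 2 * t) (pos-suc k))
                          (≡-trans (ring c (+ k)) (cong (λ t → c + t) (sym (ℤₚ.pos-+ 2 k)))))
    where ring : ∀ c k → c - k + + 2 * (+ 1 + k) ≡ c + (+ 2 + k)
          ring = solve-∀
  c≤start : c ≤ c + + suc (suc k)
  c≤start = ℤₚ.i≤i+j c (+ suc (suc k))
  split : seg (c + + d) (d ℕ.+ k) ≡ seg c k ++ progression (c + + suc (suc k)) d
  split = begin
    seg (c + + d) (d ℕ.+ k)                                ≡⟨ seg≡progression (c + + d) (d ℕ.+ k) ⟩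
    progression s (suc (d ℕ.+ k))                          ≡⟨ cong (λ l → progression s (suc l)) (ℕₚ.+-comm d k) ⟩
    progression s (suc k ℕ.+ d)                            ≡⟨ progression-++ s (suc k) d ⟩
    progression s (suc k) ++ progression (s + + 2 * + suc k) d
      ≡⟨ cong₂ _++_ (≡-trans (cong (λ t → progression t (suc k)) s≡) (sym (seg≡progression c k)))
                    (cong (λ t → progression t d) end≡) ⟩
    seg c k ++ progression (c + + suc (suc k)) d           ∎
    where open ≡-Reasoning

≤⇒≡+ : ∀ {c m} → c ≤ m → ∃ λ d → c + + d ≡ m
≤⇒≡+ {c} {m} c≤m = ∣ m - c ∣ , ≡-trans (cong (_+_ c) (ℤₚ.0≤i⇒+∣i∣≡i (ℤₚ.i≤j⇒0≤j-i c≤m))) (ring c m)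
  where ring : ∀ c m → c + (m - c) ≡ m
        ring = solve-∀

InR-seg-≥ : ∀ {c m} i → c ≤ m → InR c (seg m i)
InR-seg-≥ {c} i c≤m with ≤⇒≡+ c≤m
... | d , refl = InR-seg-+ c d i

InR-seg⊕seg : ∀ x y i n → InR (x + y) (seg x i ⊕ seg y n)
InR-seg⊕seg x y zero n =
  InR-≡ (≡-trans (cong (_⊕ seg y n) (seg-zero x)) (≡-trans (List.++-identityʳ _) (map-segˡ x y n)))
        (InR-seg (x + y) n)
InR-seg⊕seg x y i zero =
  InR-≡ (≡-trans (cong (seg x i ⊕_) (seg-zero y)) (≡-trans (⊕-singletonʳ (seg x i) y) (map-segʳ y x i)))
        (InR-seg (x + y) i)
InR-seg⊕seg x y (suc i) (suc n) =
  InR-↭ (seg-⊕-hook x y i n) (InR-++ (InR-seg (x + y) (suc n ℕ.+ suc i)) (InR-seg⊕seg x y i n))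

InR-⊕-seg : ∀ {c M} x i → InR c M → InR (c + x) (M ⊕ seg x i)
InR-⊕-seg {c} x i (ms , ns , ms≥c , _ , M↭) =
  InR-↭ (concatMap⁺ _ M↭)
        (InR-≡ (List.concatMap-++ shifted ms (concatMap (seg c) ns)) (InR-++ (singletons ms≥c) (segments ns)))
  where
  shifted : ℤ → List ℤ
  shifted m = map (_+_ m) (seg x i)
  singletons : ∀ {ms} → All (c ≤_) ms → InR (c + x) (ms ⊕ seg x i)
  singletons []                  = InR-[]
  singletons {m ∷ _} (c≤m ∷ ms≥c) =
    InR-++ (InR-≡ (map-segˡ m x i) (InR-seg-≥ i (ℤₚ.+-monoˡ-≤ x c≤m))) (singletons ms≥c)
  segments : ∀ ns → InR (c + x) (concatMap (seg c) ns ⊕ seg x i)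
  segments []       = InR-[]
  segments (n ∷ ns) = InR-≡ (List.concatMap-++ shifted (seg c n) (concatMap (seg c) ns))
                            (InR-++ (InR-seg⊕seg c x n i) (segments ns))

h~·hM : ∀ i M → h~ (+ i) ·~ hM M ≡ hM (M ⊕ seg (+ 0) i)
h~·hM i M = begin
  h~ (+ i) ·~ hM M                                      ≡⟨ List.++-identityʳ _ ⟩
  concatMap _ (hM M)                                    ≡⟨ List.concatMap-map _ _ M ⟩
  concatMap (λ j → scale~ (+ 1) (hAct i j)) M           ≡⟨ List.concatMap-cong row M ⟩
  concatMap (λ j → hM (map (_+_ j) (seg (+ 0) i))) M    ≡⟨ List.map-concatMap _ _ M ⟨
  hM (M ⊕ seg (+ 0) i)                                  ∎
  where
  open ≡-Reasoning
  row : ∀ j → scale~ (+ 1) (hAct i j) ≡ hM (map (_+_ j) (seg (+ 0) i))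
  row j = ≡-trans (sym (List.map-∘ (upTo (suc i))))
         (≡-trans (List.map-cong (λ k → cong (+ 1 ,_) (ring j (+ i) (+ (2 ℕ.* k)))) (upTo (suc i)))
         (≡-trans (List.map-∘ (upTo (suc i))) (cong hM (List.map-∘ (upTo (suc i))))))
    where ring : ∀ j i k → j - i + k ≡ j + (+ 0 - i + k)
          ring = solve-∀

coeff₁ : ℤ × ℤ → ℤ → ℤ
coeff₁ (a , i) j with i ≟ j
... | yes _ = a
... | no  _ = + 0

coeff~-∷ : ∀ x xs j → coeff~ (x ∷ xs) j ≡ coeff₁ x j + coeff~ xs j
coeff~-∷ (a , i) xs j with i ≟ j
... | yes _ = refl
... | no  _ = sym (ℤₚ.+-identityˡ _)

≈~-∷ : ∀ x {xs ys} → xs ≈~ ys → x ∷ xs ≈~ x ∷ ys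
≈~-∷ x {xs} {ys} xs≈ys j =
  ≡-trans (coeff~-∷ x xs j) (≡-trans (cong (_+_ (coeff₁ x j)) (xs≈ys j)) (sym (coeff~-∷ x ys j)))

≈~-swap : ∀ x y xs → x ∷ y ∷ xs ≈~ y ∷ x ∷ xs
≈~-swap x y xs j = begin
  coeff~ (x ∷ y ∷ xs) j                    ≡⟨ unfold₂ x y ⟩
  coeff₁ x j + (coeff₁ y j + coeff~ xs j)  ≡⟨ x∙yz≈y∙xz (coeff₁ x j) (coeff₁ y j) (coeff~ xs j) ⟩
  coeff₁ y j + (coeff₁ x j + coeff~ xs j)  ≡⟨ unfold₂ y x ⟨
  coeff~ (y ∷ x ∷ xs) j                    ∎
  where
  open ≡-Reasoning
  unfold₂ : ∀ u v → coeff~ (u ∷ v ∷ xs) j ≡ coeff₁ u j + (coeff₁ v j + coeff~ xs j)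
  unfold₂ u v = ≡-trans (coeff~-∷ u (v ∷ xs) j) (cong (_+_ (coeff₁ u j)) (coeff~-∷ v xs j))

↭⇒≈~ : ∀ {xs ys} → xs ↭ ys → xs ≈~ ys
↭⇒≈~ refl         j = refl
↭⇒≈~ (prep x p)     = ≈~-∷ x (↭⇒≈~ p)
↭⇒≈~ (swap x y p) j = ≡-trans (≈~-swap x y _ j) (≈~-∷ y (≈~-∷ x (↭⇒≈~ p)) j)
↭⇒≈~ (trans p q)  j = ≡-trans (↭⇒≈~ p j) (↭⇒≈~ q j)

lemma6 : (c : ℤ) (M : Multiset) → InR c M → (i : ℕ) →
    (h~ (+ i) ·~ hM M ≈~ hM (seg (+ 0) i ⊕ M)) × InCH2~ c (h~ (+ i) ·~ hM M)
lemma6 c M M∈R i = ≈-seg⊕M , M ⊕ seg (+ 0) i , M⊕seg∈R , ≈-M⊕seg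
  where
  ≈-M⊕seg : h~ (+ i) ·~ hM M ≈~ hM (M ⊕ seg (+ 0) i)
  ≈-M⊕seg j = cong (λ g → coeff~ g j) (h~·hM i M)
  ≈-seg⊕M : h~ (+ i) ·~ hM M ≈~ hM (seg (+ 0) i ⊕ M)
  ≈-seg⊕M j = ≡-trans (≈-M⊕seg j) (↭⇒≈~ (map⁺ (+ 1 ,_) (⊕-comm M (seg (+ 0) i))) j)
  M⊕seg∈R : InR c (M ⊕ seg (+ 0) i)
  M⊕seg∈R = subst (λ d → InR d (M ⊕ seg (+ 0) i)) (ℤₚ.+-identityʳ c) (InR-⊕-seg (+ 0) i M∈R)
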